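{- Let $a,k,p$ be positive integers with $k\le a$ and $p$ relatively prime to $a!$. Let $G=\mathbb{Z}$ or $G=\mathbb{Z}/m\mathbb{Z}$ for some $m$ that is a multiple of $a!$. Suppose $n_1,\dots,n_k\in G$ is a $k$-AP with jumps of size $p$. If $n_1\equiv n_k\pmod{a!}$, then $n_1,\dots,n_k$ is a $k$-AP. Furthermore, if there exist $1<k'<k''<k$ with $n_1\equiv n_{k''}\pmod{a!}$ and $n_{k'}\equiv n_k\pmod{a!}$, then $n_1,\dots,n_k$ is a $k$-AP.
   Context: A sequence $n_1,\dots,n_k\in G$ is a $k$-AP with jumps of size $p$ if there exists $d\in G$ such that $n_{i+1}-n_i\in\{d,d+p\}$ for all $1\le i<k$. It is a $k$-AP if there exists $d\in G$ with $n_{i+1}-n_i=d$ for all $1\le i<k$. Congruence mod $a!$ in $\mathbb{Z}/m\mathbb{Z}$ is well defined since $a!\mid m$. -}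

module Defs where

open import Data.Nat as ℕ using (ℕ; suc; _<_; _≤_)
open import Data.Integer as ℤ using (ℤ; +_; _-_; _+_)
open import Data.Integer.Divisibility as ℤD using ()
open import Data.Product using (Σ)
open import Data.Sum using (_⊎_)

-- The group G = ℤ/mℤ is modelled as ℤ up to this congruence; for m = 0 this
-- congruence is equality, i.e. G = ℤ/0ℤ = ℤ.
infix 4 _≡_[mod_]
_≡_[mod_] : ℤ → ℤ → ℕ → Set
x ≡ y [mod m ] = (+ m) ℤD.∣ (x - y)

-- Sequences n₁,…,n_k are modelled as functions ℕ → ℤ of which only the
-- values at indices 1,…,k matter.

IsAPWithJumps : (m : ℕ) (p : ℤ) (k : ℕ) (n : ℕ → ℤ) → Set
IsAPWithJumps m p k n =
  Σ ℤ λ d → ∀ i → 1 ≤ i → i < k →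
    (n (suc i) - n i ≡ d [mod m ]) ⊎ (n (suc i) - n i ≡ d + p [mod m ])

IsAP : (m : ℕ) (k : ℕ) (n : ℕ → ℤ) → Set
IsAP m k n = Σ ℤ λ d → ∀ i → 1 ≤ i → i < k → n (suc i) - n i ≡ d [mod m ]

-- Let e i ∈ {0, 1} record whether the i-th step of n is d or d + p.  Over a
-- segment n_s, …, n_t of length L = t - s ≤ a the steps telescope to
-- n_t - n_s ≡ L d + S p, where S is the number of long steps.  If n_s ≡ n_t
-- (mod a!) then, as L ∣ a! ∣ m, L divides S p, hence S because p is coprime
-- to a!.  Since 0 ≤ S ≤ L this forces S = 0 or S = L: all steps of the
-- segment have the same length.  The second claim glues the two segments
-- [1, k″] and [k′, k], which overlap in the step k′.
module Submission where

open import Defs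
open import Data.Nat using (ℕ; _≤_; _<_; _!)
open import Data.Nat.Divisibility using (_∣_)
open import Data.Nat.Coprimality using (Coprime)
open import Data.Integer using (ℤ; +_)
open import Data.Product using (_×_; Σ)

open import Data.Nat using (zero; suc; _∸_; s≤s)
import Data.Nat as ℕ
import Data.Nat.Properties as ℕₚ
open import Data.Nat.Divisibility using (_∣?_; _∣0; ∣-trans; ∣⇒≤; m∣m*n; m≤n⇒m!∣n!)
open import Data.Nat.Coprimality using (coprime-divisor)
open import Data.Integer using (_+_; _-_; _*_; ∣_∣)
import Data.Integer.Properties as ℤ
import Data.Integer.Divisibility.Signed as ℤ
open import Data.Integer.Tactic.RingSolver using (solve-∀)
open import Data.Product using (_,_)
open import Data.Sum using (_⊎_; inj₁; inj₂)
open import Data.Empty using (⊥-elim)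
open import Function using (_∘_)
open import Level using (0ℓ)
open import Relation.Binary.Bundles using (Setoid)
open import Relation.Binary.Structures using (IsEquivalence)
import Relation.Binary.Reasoning.Setoid as SetoidReasoning
open import Relation.Nullary using (Dec; yes; no)
open import Relation.Binary.PropositionalEquality
  using (_≡_; refl; sym; trans; cong; subst)

private
  ≡-mod⇒∣ : ∀ {m x y} → x ≡ y [mod m ] → + m ℤ.∣ x - y
  ≡-mod⇒∣ {m} {x} {y} = ℤ.∣ᵤ⇒∣ {+ m} {x - y}

  ∣⇒≡-mod : ∀ {m x y} → + m ℤ.∣ x - y → x ≡ y [mod m ]
  ∣⇒≡-mod {m} {x} {y} = ℤ.∣⇒∣ᵤ {+ m} {x - y}

  difference-split : ∀ x y z → x - z ≡ (x - y) + (y - z)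
  difference-split = solve-∀

  difference-+ : ∀ x y u v → (x + u) - (y + v) ≡ (x - y) + (u - v)
  difference-+ = solve-∀

≡-mod-refl : ∀ {m x} → x ≡ x [mod m ]
≡-mod-refl {m} {x} = subst (m ∣_) (cong ∣_∣ (sym (ℤ.+-inverseʳ x))) (m ∣0)

≡-mod-sym : ∀ {m x y} → x ≡ y [mod m ] → y ≡ x [mod m ]
≡-mod-sym {m} {x} {y} = subst (m ∣_) (ℤ.∣i-j∣≡∣j-i∣ x y)

≡-mod-trans : ∀ {m x y z} → x ≡ y [mod m ] → y ≡ z [mod m ] → x ≡ z [mod m ]
≡-mod-trans {m} {x} {y} {z} x≡y y≡z = ∣⇒≡-mod {m} {x} (subst (+ m ℤ.∣_) (sym (difference-split x y z))
  (ℤ.∣m∣n⇒∣m+n (≡-mod⇒∣ {m} {x} x≡y) (≡-mod⇒∣ {m} {y} y≡z)))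

+-cong-mod : ∀ {m x y u v} → x ≡ y [mod m ] → u ≡ v [mod m ] → x + u ≡ y + v [mod m ]
+-cong-mod {m} {x} {y} {u} {v} x≡y u≡v = ∣⇒≡-mod {m} {x + u} (subst (+ m ℤ.∣_) (sym (difference-+ x y u v))
  (ℤ.∣m∣n⇒∣m+n (≡-mod⇒∣ {m} {x} x≡y) (≡-mod⇒∣ {m} {u} u≡v)))

≡-mod-weaken : ∀ {k m x y} → k ∣ m → x ≡ y [mod m ] → x ≡ y [mod k ]
≡-mod-weaken {k} {m} {x} {y} = ∣-trans {k} {m} {∣ x - y ∣}

≡-mod-isEquivalence : ∀ m → IsEquivalence (λ x y → x ≡ y [mod m ])
≡-mod-isEquivalence m = record
  { refl  = λ {x} → ≡-mod-refl {m} {x}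
  ; sym   = λ {x y} → ≡-mod-sym {m} {x} {y}
  ; trans = λ {x y z} → ≡-mod-trans {m} {x} {y} {z}
  }

≡-mod-setoid : ℕ → Setoid 0ℓ 0ℓ
≡-mod-setoid m = record { isEquivalence = ≡-mod-isEquivalence m }

module ≡-mod-Reasoning (m : ℕ) = SetoidReasoning (≡-mod-setoid m)

_≡?_[mod_] : ∀ x y m → Dec (x ≡ y [mod m ])
x ≡? y [mod m ] = m ∣? ∣ x - y ∣

m∣n⇒n≡0∨m≤n : ∀ {m n} → m ∣ n → n ≡ 0 ⊎ m ≤ n
m∣n⇒n≡0∨m≤n {n = zero}  _   = inj₁ refl
m∣n⇒n≡0∨m≤n {n = suc _} m∣n = inj₂ (∣⇒≤ m∣n)

0<m≤n⇒m∣n! : ∀ {m n} → 0 < m → m ≤ n → m ∣ n !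
0<m≤n⇒m∣n! {suc l} _ l<n = ∣-trans (m∣m*n (l !)) (m≤n⇒m!∣n! l<n)

sumBelow : ℕ → (ℕ → ℕ) → ℕ
sumBelow zero    f = 0
sumBelow (suc L) f = sumBelow L f ℕ.+ f L

ConstantOn : (ℕ → ℕ) → ℕ → ℕ → Set
ConstantOn f s t = Σ ℕ λ c → ∀ i → s ≤ i → i < t → f i ≡ c

sumBelow≡0⇒≡0 : ∀ {f} L → sumBelow L f ≡ 0 → ∀ i → i < L → f i ≡ 0
sumBelow≡0⇒≡0 {f} (suc L) sum≡0 i i<1+L with ℕₚ.m≤n⇒m<n∨m≡n (ℕₚ.≤-pred i<1+L)
... | inj₁ i<L  = sumBelow≡0⇒≡0 L (ℕₚ.m+n≡0⇒m≡0 (sumBelow L f) sum≡0) i i<L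
... | inj₂ refl = ℕₚ.m+n≡0⇒n≡0 (sumBelow L f) sum≡0

module _ {f : ℕ → ℕ} (f≤1 : ∀ i → f i ≤ 1) where

  sumBelow≤ : ∀ L → sumBelow L f ≤ L
  sumBelow≤ zero    = ℕₚ.≤-refl
  sumBelow≤ (suc L) = subst (sumBelow L f ℕ.+ f L ≤_) (ℕₚ.+-comm L 1) (ℕₚ.+-mono-≤ (sumBelow≤ L) (f≤1 L))

  sumBelow≡L⇒≡1 : ∀ L → sumBelow L f ≡ L → ∀ i → i < L → f i ≡ 1
  sumBelow≡L⇒≡1 (suc L) sum≡1+L i i<1+L with f L in fL≡ | f≤1 L
  ... | 0 | _ = ⊥-elim (ℕₚ.1+n≰n (subst (_≤ L) (trans (sym (ℕₚ.+-identityʳ _)) sum≡1+L) (sumBelow≤ L)))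
  ... | suc (suc _) | s≤s ()
  ... | 1 | _ with ℕₚ.m≤n⇒m<n∨m≡n (ℕₚ.≤-pred i<1+L)
  ...   | inj₁ i<L  = sumBelow≡L⇒≡1 L (ℕₚ.+-cancelʳ-≡ _ _ L (trans sum≡1+L (ℕₚ.+-comm 1 L))) i i<L
  ...   | inj₂ refl = fL≡

  ∣sumBelow⇒constantOn : ∀ L → L ∣ sumBelow L f → ConstantOn f 0 L
  ∣sumBelow⇒constantOn L L∣sum with m∣n⇒n≡0∨m≤n L∣sum
  ... | inj₁ sum≡0 = 0 , λ i _ → sumBelow≡0⇒≡0 L sum≡0 i
  ... | inj₂ L≤sum = 1 , λ i _ → sumBelow≡L⇒≡1 L (ℕₚ.≤-antisym (sumBelow≤ L) L≤sum) i

constantOn-shift : ∀ {f s t} → ConstantOn (λ j → f (j ℕ.+ s)) 0 (t ∸ s) → ConstantOn f s t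
constantOn-shift {f} {s} (c , f≡c) = c , λ i s≤i i<t →
  subst (λ j → f j ≡ c) (ℕₚ.m∸n+n≡m s≤i) (f≡c (i ∸ s) ℕ.z≤n (ℕₚ.∸-monoˡ-< i<t s≤i))

constantOn-glue : ∀ {f s t u v} → s ≤ u → u < t → u < v →
  ConstantOn f s t → ConstantOn f u v → ConstantOn f s v
constantOn-glue {f} {s} {t} {u} {v} s≤u u<t u<v (c , f≡c) (c′ , f≡c′) = c , glued
  where
  c′≡c : c′ ≡ c
  c′≡c = trans (sym (f≡c′ u ℕₚ.≤-refl u<v)) (f≡c u s≤u u<t)

  glued : ∀ i → s ≤ i → i < v → f i ≡ c
  glued i s≤i i<v with i ℕ.<? t
  ... | yes i<t = f≡c i s≤i i<t
  ... | no  i≮t = trans (f≡c′ i (ℕₚ.≤-trans (ℕₚ.<⇒≤ u<t) (ℕₚ.≮⇒≥ i≮t)) i<v) c′≡c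

module Steps (m : ℕ) (x : ℕ → ℤ) (d : ℤ) (p : ℕ) where

  StepsOn : (ℕ → ℕ) → ℕ → ℕ → Set
  StepsOn b s t = ∀ i → s ≤ i → i < t → x (suc i) - x i ≡ d + + b i * + p [mod m ]

  telescope : ∀ b L s → StepsOn b s (L ℕ.+ s) →
    x (L ℕ.+ s) - x s ≡ + L * d + + sumBelow L (λ j → b (j ℕ.+ s)) * + p [mod m ]
  telescope b zero s _ = begin
    x s - x s ≡⟨ ℤ.+-inverseʳ (x s) ⟩
    + 0       ∎
    where open ≡-mod-Reasoning m
  telescope b (suc L) s steps = begin
    x′ - x s                    ≡⟨ difference-split x′ x″ (x s) ⟩
    (x′ - x″) + (x″ - x s)      ≈⟨ +-cong-mod {m} {x′ - x″} {step} {x″ - x s} {rest} last (telescope b L s earlier) ⟩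
    step + rest                 ≡⟨ collect d (+ b (L ℕ.+ s)) (+ p) (+ L) (+ S) ⟩
    + suc L * d + + (S ℕ.+ b (L ℕ.+ s)) * + p ∎
    where
    open ≡-mod-Reasoning m
    S = sumBelow L (λ j → b (j ℕ.+ s))
    x′ = x (suc L ℕ.+ s)
    x″ = x (L ℕ.+ s)
    step = d + + b (L ℕ.+ s) * + p
    rest = + L * d + + S * + p

    last : x′ - x″ ≡ step [mod m ]
    last = steps (L ℕ.+ s) (ℕₚ.m≤n+m s L) (ℕₚ.n<1+n _)

    earlier : StepsOn b s (L ℕ.+ s)
    earlier i s≤i i<L+s = steps i s≤i (ℕₚ.m<n⇒m<1+n i<L+s)

    -- `+ suc L` and `+ (S ℕ.+ e)` reduce to `+ 1 + + L` and `+ S + + e`.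
    collect : ∀ d e p L S → (d + e * p) + (L * d + S * p) ≡ (+ 1 + L) * d + (S + e) * p
    collect = solve-∀

  constantOn-jumps : ∀ {b s t} → (∀ i → b i ≤ 1) → s ≤ t → (t ∸ s) ∣ m → Coprime (t ∸ s) p →
    StepsOn b s t → x s ≡ x t [mod t ∸ s ] → ConstantOn b s t
  constantOn-jumps {b} {s} {t} b≤1 s≤t L∣m L⊥p steps xₛ≡xₜ =
    constantOn-shift (∣sumBelow⇒constantOn (b≤1 ∘ (ℕ._+ s)) L L∣S)
    where
    L = t ∸ s
    S = sumBelow L (λ j → b (j ℕ.+ s))
    total = + L * d + + S * + p

    L+s≡t : L ℕ.+ s ≡ t
    L+s≡t = ℕₚ.m∸n+n≡m s≤t

    xₜ-xₛ≡total : x t - x s ≡ total [mod L ]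
    xₜ-xₛ≡total = ≡-mod-weaken {L} {m} {x t - x s} L∣m
      (subst (λ t′ → x t′ - x s ≡ total [mod m ]) L+s≡t
        (telescope b L s (subst (StepsOn b s) (sym L+s≡t) steps)))

    L∣total : + L ℤ.∣ total
    L∣total = subst (+ L ℤ.∣_) (i-[i-j]≡j (x t - x s) total)
      (ℤ.∣m∣n⇒∣m-n (≡-mod⇒∣ {L} {x t} (≡-mod-sym {L} {x s} xₛ≡xₜ)) (≡-mod⇒∣ {L} {x t - x s} xₜ-xₛ≡total))
      where
      i-[i-j]≡j : ∀ i j → i - (i - j) ≡ j
      i-[i-j]≡j = solve-∀

    L∣p*S : L ∣ p ℕ.* S
    L∣p*S = subst (L ∣_) (trans (ℤ.abs-* (+ S) (+ p)) (ℕₚ.*-comm S p))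
      (ℤ.∣⇒∣ᵤ (ℤ.∣m+n∣m⇒∣n L∣total (ℤ.∣m⇒∣m*n d ℤ.∣-refl)))

    L∣S : L ∣ S
    L∣S = coprime-divisor L⊥p L∣p*S

jump : ℕ → ℤ → ℤ → ℕ
jump m u d with u ≡? d [mod m ]
... | yes _ = 0
... | no  _ = 1

jump≤1 : ∀ m u d → jump m u d ≤ 1
jump≤1 m u d with u ≡? d [mod m ]
... | yes _ = ℕ.z≤n
... | no  _ = ℕₚ.≤-refl

jump-step : ∀ {m u d q} → u ≡ d [mod m ] ⊎ u ≡ d + q [mod m ] → u ≡ d + + jump m u d * q [mod m ]
jump-step {m} {u} {d} {q} short-or-long with u ≡? d [mod m ] | short-or-long
... | yes u≡d | _         = subst (λ v → u ≡ v [mod m ]) (sym (ℤ.+-identityʳ d)) u≡d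
... | no  u≢d | inj₁ u≡d  = ⊥-elim (u≢d u≡d)
... | no  _   | inj₂ u≡d+q = subst (λ v → u ≡ d + v [mod m ]) (sym (ℤ.*-identityˡ q)) u≡d+q

lemma7p10 : (a k p m : ℕ) → 1 ≤ a → 1 ≤ k → 1 ≤ p → k ≤ a → Coprime p (a !) → (a !) ∣ m →
    (n : ℕ → ℤ) → IsAPWithJumps m (+ p) k n →
    ((n 1 ≡ n k [mod a ! ]) → IsAP m k n)
    × ((Σ ℕ λ k′ → Σ ℕ λ k″ → 1 < k′ × k′ < k″ × k″ < k
          × (n 1 ≡ n k″ [mod a ! ]) × (n k′ ≡ n k [mod a ! ]))
        → IsAP m k n)
lemma7p10 a k p m _ 1≤k _ k≤a p⊥a! a!∣m n (d , short-or-long) = first , second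
  where
  open Steps m n d p

  e : ℕ → ℕ
  e i = jump m (n (suc i) - n i) d

  steps : StepsOn e 1 k
  steps i 1≤i i<k = jump-step {m} {n (suc i) - n i} {d} {+ p} (short-or-long i 1≤i i<k)

  segment : ∀ {s t} → 1 ≤ s → s ≤ t → t ≤ k → n s ≡ n t [mod a ! ] → ConstantOn e s t
  segment {s} {t} 1≤s s≤t t≤k nₛ≡nₜ with ℕₚ.m≤n⇒m<n∨m≡n s≤t
  ... | inj₂ refl = 0 , λ i s≤i i<s → ⊥-elim (ℕₚ.<⇒≱ i<s s≤i)
  ... | inj₁ s<t  = constantOn-jumps (λ i → jump≤1 m _ d) s≤t (∣-trans L∣a! a!∣m) L⊥p
      (λ i s≤i i<t → steps i (ℕₚ.≤-trans 1≤s s≤i) (ℕₚ.<-≤-trans i<t t≤k))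
      (≡-mod-weaken {t ∸ s} {a !} {n s} L∣a! nₛ≡nₜ)
    where
    L∣a! : t ∸ s ∣ a !
    L∣a! = 0<m≤n⇒m∣n! (ℕₚ.m<n⇒0<n∸m s<t) (ℕₚ.≤-trans (ℕₚ.m∸n≤m t s) (ℕₚ.≤-trans t≤k k≤a))

    L⊥p : Coprime (t ∸ s) p
    L⊥p (i∣L , i∣p) = p⊥a! (i∣p , ∣-trans i∣L L∣a!)

  isAP : ConstantOn e 1 k → IsAP m k n
  isAP (c , e≡c) = d + + c * + p , λ i 1≤i i<k →
    subst (λ b → n (suc i) - n i ≡ d + + b * + p [mod m ]) (e≡c i 1≤i i<k) (steps i 1≤i i<k)

  first : n 1 ≡ n k [mod a ! ] → IsAP m k n
  first n₁≡nₖ = isAP (segment ℕₚ.≤-refl 1≤k ℕₚ.≤-refl n₁≡nₖ)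

  second : (Σ ℕ λ k′ → Σ ℕ λ k″ → 1 < k′ × k′ < k″ × k″ < k
             × (n 1 ≡ n k″ [mod a ! ]) × (n k′ ≡ n k [mod a ! ])) → IsAP m k n
  second (k′ , k″ , 1<k′ , k′<k″ , k″<k , n₁≡nₖ″ , nₖ′≡nₖ) =
    isAP (constantOn-glue (ℕₚ.<⇒≤ 1<k′) k′<k″ k′<k
      (segment ℕₚ.≤-refl (ℕₚ.<⇒≤ 1<k″) (ℕₚ.<⇒≤ k″<k) n₁≡nₖ″)
      (segment (ℕₚ.<⇒≤ 1<k′) (ℕₚ.<⇒≤ k′<k) ℕₚ.≤-refl nₖ′≡nₖ))
    where
    k′<k = ℕₚ.<-trans k′<k″ k″<k
    1<k″ = ℕₚ.<-trans 1<k′ k′<k″
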